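{- Every interval graph is a single approval interval graph, and there exist single approval interval graphs that are not interval graphs.
   Context: All graphs are finite and simple. A graph is an interval graph if one can assign to each vertex a closed real interval so that two distinct vertices are adjacent iff their intervals intersect. An approval interval is a triple $I(a)=(a_l,a_a,a_r)$ of reals with $a_l<a_a<a_r$. A single approval interval representation of a graph $G$ assigns to each vertex $a$ an approval interval $I(a)$ such that distinct vertices $a,b$ are adjacent if and only if $[a_l,a_r]$ and $[b_l,b_r]$ intersect and their intersection contains exactly one of the approval marks $a_a,b_a$. A graph is a single approval interval graph if it has such a representation.
   Formalization: The endpoints of the closed intervals and the approval marks $a_l,a_a,a_r$ are rational rather than real, in interval and single approval interval representations alike. -}

module Defs where

open import Level using (0ℓ)
open import Data.Nat using (ℕ)
open import Data.Fin using (Fin)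
open import Data.Rational using (ℚ; _≤_; _<_)
open import Data.Product using (_×_; Σ)
open import Data.Sum using (_⊎_)
open import Relation.Nullary using (¬_)
open import Relation.Binary.PropositionalEquality using (_≡_)
open import Function.Bundles using (_⇔_)

record Graph (n : ℕ) : Set₁ where
  field
    Adj     : Fin n → Fin n → Set
    symAdj  : ∀ {i j} → Adj i j → Adj j i
    irrefl  : ∀ {i} → ¬ Adj i i

open Graph public

_∈[_,_] : ℚ → ℚ → ℚ → Set
x ∈[ l , r ] = (l ≤ x) × (x ≤ r)

Intersect : ℚ → ℚ → ℚ → ℚ → Set
Intersect l₁ r₁ l₂ r₂ = (l₁ ≤ r₂) × (l₂ ≤ r₁)

IsIntervalGraph : ∀ {n} → Graph n → Set
IsIntervalGraph {n} G =
  Σ (Fin n → ℚ) λ l → Σ (Fin n → ℚ) λ r →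
    (∀ i → l i ≤ r i) ×
    (∀ i j → ¬ (i ≡ j) → (Adj G i j ⇔ Intersect (l i) (r i) (l j) (r j)))

record ApprovalInterval : Set where
  constructor ⟨_,_,_⟩[_,_]
  field
    left    : ℚ
    approve : ℚ
    right   : ℚ
    l<a     : left < approve
    a<r     : approve < right

open ApprovalInterval public

InBoth : ApprovalInterval → ApprovalInterval → ℚ → Set
InBoth a b x = (x ∈[ left a , right a ]) × (x ∈[ left b , right b ])

SAAdjacent : ApprovalInterval → ApprovalInterval → Set
SAAdjacent a b =
  Intersect (left a) (right a) (left b) (right b) ×
  ((InBoth a b (approve a) × ¬ InBoth a b (approve b)) ⊎
   (¬ InBoth a b (approve a) × InBoth a b (approve b)))

IsSingleApprovalIntervalGraph : ∀ {n} → Graph n → Set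
IsSingleApprovalIntervalGraph {n} G =
  Σ (Fin n → ApprovalInterval) λ I →
    ∀ i j → ¬ (i ≡ j) → (Adj G i j ⇔ SAAdjacent (I i) (I j))

{-# OPTIONS --safe #-}
-- Only the relative order of the endpoints of an interval representation matters. Rank the
-- right endpoints, breaking ties by vertex index, and replace each left endpoint by the number
-- of right endpoints strictly before it: this gives integer intervals [lo a , hi a] with the
-- same intersections and pairwise distinct right ends. Stretch [lo , hi] to [3 lo , 3 hi + 2]
-- with its mark at 3 hi + 1: when two such intervals meet, the mark of the one ending first
-- lies in both, while the other mark lies beyond the right end of the first.
-- Conversely, two copies each of the approval intervals (0,1,2) and (0,4,5) represent the
-- 4-cycle, which is not an interval graph: if two opposite intervals of a 4-cycle are
-- disjoint, the other two both cover the gap between them and hence meet.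
module Submission where

open import Defs
open import Data.Nat using (ℕ)
open import Data.Product using (_×_; Σ)
open import Relation.Nullary using (¬_)

open import Data.Nat as ℕ using (suc; _+_; _*_; z≤n)
import Data.Nat.Properties as ℕ
open import Data.Integer using (+_; +≤+; +<+)
import Data.Integer as ℤ
import Data.Integer.Properties as ℤ
open import Data.Rational as ℚ using (ℚ)
open import Data.Rational.Literals using (fromℤ)
import Data.Rational.Properties as ℚ
open import Data.Fin using (Fin; #_)
import Data.Fin.Properties as Fin
open import Data.Fin.Subset using (Subset; ∣_∣; _∈_)
open import Data.Fin.Subset.Properties using (p⊆q⇒∣p∣≤∣q∣; p⊂q⇒∣p∣<∣q∣)
open import Data.Vec using (tabulate; lookup; []; _∷_)
open import Data.Vec.Properties using (lookup∘tabulate; []=⇒lookup; lookup⇒[]=)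
open import Data.Product using (_,_; swap)
open import Data.Product.Function.NonDependent.Propositional using (_×-⇔_)
open import Data.Product.Relation.Binary.Lex.Strict using (×-strictTotalOrder)
open import Data.Empty using (⊥-elim)
open import Data.Sum using (_⊎_; inj₁; inj₂; [_,_]′)
open import Function using (_∘_)
open import Function.Bundles using (_⇔_; mk⇔; Equivalence)
import Function.Properties.Equivalence as ⇔
open import Relation.Binary.Bundles using (StrictTotalOrder)
open import Relation.Binary.Definitions using (tri<; tri≈; tri>)
open import Relation.Binary.PropositionalEquality using (_≡_; _≢_; refl; sym; trans; subst₂)
open import Relation.Nullary using (yes; no; does)
open import Relation.Nullary.Decidable using (dec-true)
open import Relation.Unary using (Pred; Decidable; _⊆_)

satisfying : ∀ {n ℓ} {P : Pred (Fin n) ℓ} → Decidable P → Subset n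
satisfying P? = tabulate (does ∘ P?)

module _ {n ℓ} {P : Pred (Fin n) ℓ} (P? : Decidable P) where

  ∈-satisfying⁺ : ∀ {i} → P i → i ∈ satisfying P?
  ∈-satisfying⁺ {i} p =
    lookup⇒[]= i _ (trans (lookup∘tabulate (does ∘ P?) i) (dec-true (P? i) p))

  ∈-satisfying⁻ : ∀ {i} → i ∈ satisfying P? → P i
  ∈-satisfying⁻ {i} i∈ with P? i | trans (sym (lookup∘tabulate (does ∘ P?) i)) ([]=⇒lookup i∈)
  ... | yes p | _  = p
  ... | no _  | ()

count : ∀ {n ℓ} {P : Pred (Fin n) ℓ} → Decidable P → ℕ
count P? = ∣ satisfying P? ∣

module _ {n ℓ} {P Q : Pred (Fin n) ℓ} (P? : Decidable P) (Q? : Decidable Q) (P⊆Q : P ⊆ Q) where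

  private
    satisfying-⊆ : ∀ {i} → i ∈ satisfying P? → i ∈ satisfying Q?
    satisfying-⊆ = ∈-satisfying⁺ Q? ∘ P⊆Q ∘ ∈-satisfying⁻ P?

  count-mono : count P? ℕ.≤ count Q?
  count-mono = p⊆q⇒∣p∣≤∣q∣ satisfying-⊆

  count-strict : ∀ {i} → Q i → ¬ P i → count P? ℕ.< count Q?
  count-strict {i} qi ¬pi =
    p⊂q⇒∣p∣<∣q∣ (satisfying-⊆ , i , ∈-satisfying⁺ Q? qi , ¬pi ∘ ∈-satisfying⁻ P?)

fromℕ : ℕ → ℚ
fromℕ n = fromℤ (+ n)

fromℕ-mono-≤ : ∀ {m n} → m ℕ.≤ n → fromℕ m ℚ.≤ fromℕ n
fromℕ-mono-≤ {m} {n} m≤n =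
  ℚ.*≤* (subst₂ ℤ._≤_ (sym (ℤ.*-identityʳ (+ m))) (sym (ℤ.*-identityʳ (+ n))) (+≤+ m≤n))

fromℕ-mono-< : ∀ {m n} → m ℕ.< n → fromℕ m ℚ.< fromℕ n
fromℕ-mono-< {m} {n} m<n =
  ℚ.*<* (subst₂ ℤ._<_ (sym (ℤ.*-identityʳ (+ m))) (sym (ℤ.*-identityʳ (+ n))) (+<+ m<n))

fromℕ-cancel-≤ : ∀ {m n} → fromℕ m ℚ.≤ fromℕ n → m ℕ.≤ n
fromℕ-cancel-≤ {m} {n} (ℚ.*≤* m≤n) =
  ℤ.drop‿+≤+ (subst₂ ℤ._≤_ (ℤ.*-identityʳ (+ m)) (ℤ.*-identityʳ (+ n)) m≤n)

*-+-cancel-≤ : ∀ k {x y i j} → j ℕ.< k → k * x + i ℕ.≤ k * y + j → x ℕ.≤ y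
*-+-cancel-≤ k {x} {y} {i} {j} j<k kx+i≤ky+j = ℕ.≮⇒≥ λ y<x → ℕ.<⇒≱ (begin-strict
  k * y + j   <⟨ ℕ.+-monoʳ-< (k * y) j<k ⟩
  k * y + k   ≡⟨ ℕ.+-comm (k * y) k ⟩
  k + k * y   ≡⟨ ℕ.*-suc k y ⟨
  k * suc y   ≤⟨ ℕ.*-monoʳ-≤ k y<x ⟩
  k * x       ≤⟨ ℕ.m≤m+n (k * x) i ⟩
  k * x + i   ∎) kx+i≤ky+j
  where open ℕ.≤-Reasoning

SAAdjacent-sym : ∀ {a b} → SAAdjacent a b → SAAdjacent b a
SAAdjacent-sym ((la≤rb , lb≤ra) , inj₁ (a-in , b-out)) =
  (lb≤ra , la≤rb) , inj₂ (b-out ∘ swap , swap a-in)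
SAAdjacent-sym ((la≤rb , lb≤ra) , inj₂ (a-out , b-in)) =
  (lb≤ra , la≤rb) , inj₁ (swap b-in , a-out ∘ swap)

SAAdjacent-irrefl : ∀ {a} → ¬ SAAdjacent a a
SAAdjacent-irrefl (_ , inj₁ (a-in , a-out)) = a-out a-in
SAAdjacent-irrefl (_ , inj₂ (a-out , a-in)) = a-out a-in

point : ℕ → ℕ → ℚ
point x i = fromℕ (3 * x + i)

point-mono-≤ : ∀ {x y i j} → x ℕ.≤ y → i ℕ.≤ j → point x i ℚ.≤ point y j
point-mono-≤ x≤y i≤j = fromℕ-mono-≤ (ℕ.+-mono-≤ (ℕ.*-monoʳ-≤ 3 x≤y) i≤j)

point-cancel-≤ : ∀ {x y i} → point x i ℚ.≤ point y 2 → x ℕ.≤ y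
point-cancel-≤ = *-+-cancel-≤ 3 (ℕ.n<1+n 2) ∘ fromℕ-cancel-≤

block : (lo hi : ℕ) → lo ℕ.≤ hi → ApprovalInterval
block lo hi lo≤hi = ⟨ point lo 0 , point hi 1 , point hi 2 ⟩[
  fromℕ-mono-< (ℕ.+-mono-≤-< (ℕ.*-monoʳ-≤ 3 lo≤hi) (ℕ.n<1+n 0)) ,
  fromℕ-mono-< (ℕ.+-monoʳ-< (3 * hi) (ℕ.n<1+n 1)) ]

module _ {lo₁ hi₁ lo₂ hi₂} (lo₁≤hi₁ : lo₁ ℕ.≤ hi₁) (lo₂≤hi₂ : lo₂ ℕ.≤ hi₂) where

  private
    I₁ I₂ : ApprovalInterval
    I₁ = block lo₁ hi₁ lo₁≤hi₁
    I₂ = block lo₂ hi₂ lo₂≤hi₂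

  block-SAAdjacent⇒overlap : SAAdjacent I₁ I₂ → lo₁ ℕ.≤ hi₂ × lo₂ ℕ.≤ hi₁
  block-SAAdjacent⇒overlap ((l₁≤r₂ , l₂≤r₁) , _) = point-cancel-≤ l₁≤r₂ , point-cancel-≤ l₂≤r₁

  block-overlap⇒SAAdjacent : hi₁ ℕ.< hi₂ → lo₁ ℕ.≤ hi₂ → lo₂ ℕ.≤ hi₁ → SAAdjacent I₁ I₂
  block-overlap⇒SAAdjacent hi₁<hi₂ lo₁≤hi₂ lo₂≤hi₁ =
    (point-mono-≤ lo₁≤hi₂ z≤n , point-mono-≤ lo₂≤hi₁ z≤n) ,
    inj₁ ( ( (point-mono-≤ lo₁≤hi₁ z≤n , point-mono-≤ (ℕ.≤-refl {hi₁}) 1≤2)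
           , (point-mono-≤ lo₂≤hi₁ z≤n , point-mono-≤ (ℕ.<⇒≤ hi₁<hi₂) 1≤2))
         , λ ((_ , mark₂≤right₁) , _) → ℕ.<⇒≱ hi₁<hi₂ (point-cancel-≤ mark₂≤right₁))
    where
    1≤2 : 1 ℕ.≤ 2
    1≤2 = ℕ.n≤1+n 1

block-SAAdjacent⇔overlap : ∀ {lo₁ hi₁ lo₂ hi₂} (lo₁≤hi₁ : lo₁ ℕ.≤ hi₁) (lo₂≤hi₂ : lo₂ ℕ.≤ hi₂) →
  hi₁ ≢ hi₂ →
  SAAdjacent (block lo₁ hi₁ lo₁≤hi₁) (block lo₂ hi₂ lo₂≤hi₂) ⇔ (lo₁ ℕ.≤ hi₂ × lo₂ ℕ.≤ hi₁)
block-SAAdjacent⇔overlap {lo₁} {hi₁} {lo₂} {hi₂} p₁ p₂ hi₁≢hi₂ =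
  mk⇔ (block-SAAdjacent⇒overlap p₁ p₂) overlap⇒SAAdjacent
  where
  overlap⇒SAAdjacent : lo₁ ℕ.≤ hi₂ × lo₂ ℕ.≤ hi₁ → SAAdjacent (block lo₁ hi₁ p₁) (block lo₂ hi₂ p₂)
  overlap⇒SAAdjacent (lo₁≤hi₂ , lo₂≤hi₁) with ℕ.<-cmp hi₁ hi₂
  ... | tri< hi₁<hi₂ _ _ = block-overlap⇒SAAdjacent p₁ p₂ hi₁<hi₂ lo₁≤hi₂ lo₂≤hi₁
  ... | tri≈ _ hi₁≡hi₂ _ = ⊥-elim (hi₁≢hi₂ hi₁≡hi₂)
  ... | tri> _ _ hi₂<hi₁ = SAAdjacent-sym {block lo₂ hi₂ p₂} {block lo₁ hi₁ p₁}
      (block-overlap⇒SAAdjacent p₂ p₁ hi₂<hi₁ lo₂≤hi₁ lo₁≤hi₂)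

module RightEndpointRanks {n} (l r : Fin n → ℚ) where

  open StrictTotalOrder (×-strictTotalOrder ℚ.<-strictTotalOrder (Fin.<-strictTotalOrder n))
    using ()
    renaming ( _<_ to _<ₗₑₓ_; _<?_ to _<ₗₑₓ?_; compare to compareₗₑₓ
             ; trans to <ₗₑₓ-trans; irrefl to <ₗₑₓ-irrefl)

  key : Fin n → ℚ × Fin n
  key j = r j , j

  endsBefore? : (x : ℚ) → Decidable (λ j → r j ℚ.< x)
  endsBefore? x j = r j ℚ.<? x

  precedes? : (b : Fin n) → Decidable (λ j → key j <ₗₑₓ key b)
  precedes? b j = key j <ₗₑₓ? key b

  lo hi : Fin n → ℕ
  lo a = count (endsBefore? (l a))
  hi b = count (precedes? b)

  key<⇒r≤r : ∀ {a b} → key a <ₗₑₓ key b → r a ℚ.≤ r b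
  key<⇒r≤r (inj₁ ra<rb)       = ℚ.<⇒≤ ra<rb
  key<⇒r≤r (inj₂ (ra≡rb , _)) = ℚ.≤-reflexive ra≡rb

  l≤r⇒lo≤hi : ∀ {a b} → l a ℚ.≤ r b → lo a ℕ.≤ hi b
  l≤r⇒lo≤hi {a} {b} la≤rb = count-mono (endsBefore? (l a)) (precedes? b)
    (λ rj<la → inj₁ (ℚ.<-≤-trans rj<la la≤rb))

  r<l⇒hi<lo : ∀ {a b} → r b ℚ.< l a → hi b ℕ.< lo a
  r<l⇒hi<lo {a} {b} rb<la = count-strict (precedes? b) (endsBefore? (l a))
    (λ j<b → ℚ.≤-<-trans (key<⇒r≤r j<b) rb<la) rb<la (<ₗₑₓ-irrefl (refl , refl))

  key<⇒hi<hi : ∀ {a b} → key a <ₗₑₓ key b → hi a ℕ.< hi b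
  key<⇒hi<hi {a} {b} a<b = count-strict (precedes? a) (precedes? b)
    (λ j<a → <ₗₑₓ-trans j<a a<b) a<b (<ₗₑₓ-irrefl (refl , refl))

  hi-injective : ∀ {a b} → hi a ≡ hi b → a ≡ b
  hi-injective {a} {b} ha≡hb with compareₗₑₓ (key a) (key b)
  ... | tri< a<b _ _       = ⊥-elim (ℕ.<-irrefl ha≡hb (key<⇒hi<hi a<b))
  ... | tri≈ _ (_ , a≡b) _ = a≡b
  ... | tri> _ _ b<a       = ⊥-elim (ℕ.<-irrefl (sym ha≡hb) (key<⇒hi<hi b<a))

  l≤r⇔lo≤hi : ∀ {a b} → l a ℚ.≤ r b ⇔ lo a ℕ.≤ hi b
  l≤r⇔lo≤hi = mk⇔ l≤r⇒lo≤hi (λ lo≤hi → ℚ.≮⇒≥ (λ rb<la → ℕ.<⇒≱ (r<l⇒hi<lo rb<la) lo≤hi))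

interval⇒singleApproval : ∀ {n} (G : Graph n) → IsIntervalGraph G → IsSingleApprovalIntervalGraph G
interval⇒singleApproval {n} G (l , r , l≤r , adj⇔intersect) = I , adj⇔SAAdjacent
  where
  open RightEndpointRanks l r

  lo≤hi : ∀ a → lo a ℕ.≤ hi a
  lo≤hi a = l≤r⇒lo≤hi (l≤r a)

  I : Fin n → ApprovalInterval
  I a = block (lo a) (hi a) (lo≤hi a)

  adj⇔SAAdjacent : ∀ a b → a ≢ b → Adj G a b ⇔ SAAdjacent (I a) (I b)
  adj⇔SAAdjacent a b a≢b =
    ⇔.trans (adj⇔intersect a b a≢b)
      (⇔.trans (l≤r⇔lo≤hi ×-⇔ l≤r⇔lo≤hi)
        (⇔.sym (block-SAAdjacent⇔overlap (lo≤hi a) (lo≤hi b) (a≢b ∘ hi-injective))))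

approvalGraph : ∀ {n} → (Fin n → ApprovalInterval) → Graph n
approvalGraph I = record
  { Adj    = λ a b → SAAdjacent (I a) (I b)
  ; symAdj = λ {a} {b} → SAAdjacent-sym {I a} {I b}
  ; irrefl = λ {a} → SAAdjacent-irrefl {I a}
  }

approvalGraph-isSingleApproval : ∀ {n} (I : Fin n → ApprovalInterval) →
  IsSingleApprovalIntervalGraph (approvalGraph I)
approvalGraph-isSingleApproval I = I , λ _ _ _ → ⇔.refl

module _ {A : Set} (l r : A → ℚ) where

  Meets : A → A → Set
  Meets a b = Intersect (l a) (r a) (l b) (r b)

  -- Each of b and d meets both a and c, so it covers the gap [r a , l c] between them.
  meet-across-gap : ∀ {a b c d} → r a ℚ.< l c →
    Meets a b → Meets b c → Meets c d → Meets d a → Meets b d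
  meet-across-gap ra<lc (_ , lb≤ra) (_ , lc≤rb) (lc≤rd , _) (ld≤ra , _) =
    ℚ.<⇒≤ (ℚ.≤-<-trans lb≤ra (ℚ.<-≤-trans ra<lc lc≤rd)) ,
    ℚ.<⇒≤ (ℚ.≤-<-trans ld≤ra (ℚ.<-≤-trans ra<lc lc≤rb))

  4-cycle-chord : ∀ {a b c d} →
    Meets a b → Meets b c → Meets c d → Meets d a → Meets a c ⊎ Meets b d
  4-cycle-chord {a} {b} {c} {d} ab bc cd da with l a ℚ.≤? r c | l c ℚ.≤? r a
  ... | yes la≤rc | yes lc≤ra = inj₁ (la≤rc , lc≤ra)
  ... | _         | no lc≰ra  = inj₂ (meet-across-gap (ℚ.≰⇒> lc≰ra) ab bc cd da)
  ... | no la≰rc  | _         = inj₂ (swap (meet-across-gap (ℚ.≰⇒> la≰rc) cd da ab bc))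

short long : ApprovalInterval
short = block 0 0 z≤n
long  = block 0 1 z≤n

short-long : SAAdjacent short long
short-long = block-overlap⇒SAAdjacent z≤n z≤n (ℕ.n<1+n 0) z≤n z≤n

long-short : SAAdjacent long short
long-short = SAAdjacent-sym {short} {long} short-long

C₄-intervals : Fin 4 → ApprovalInterval
C₄-intervals = lookup (short ∷ long ∷ short ∷ long ∷ [])

C₄ : Graph 4
C₄ = approvalGraph C₄-intervals

C₄-notInterval : ¬ IsIntervalGraph C₄
C₄-notInterval (l , r , _ , adj⇔intersect) =
  [ SAAdjacent-irrefl {short} ∘ from (# 0) (# 2) (λ ())
  , SAAdjacent-irrefl {long}  ∘ from (# 1) (# 3) (λ ()) ]′
    (4-cycle-chord l r (to (# 0) (# 1) (λ ()) short-long) (to (# 1) (# 2) (λ ()) long-short)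
                       (to (# 2) (# 3) (λ ()) short-long) (to (# 3) (# 0) (λ ()) long-short))
  where
  to : ∀ i j → i ≢ j → Adj C₄ i j → Meets l r i j
  to i j i≢j = Equivalence.to (adj⇔intersect i j i≢j)

  from : ∀ i j → i ≢ j → Meets l r i j → Adj C₄ i j
  from i j i≢j = Equivalence.from (adj⇔intersect i j i≢j)

theorem24 : ((n : ℕ) (G : Graph n) → IsIntervalGraph G → IsSingleApprovalIntervalGraph G)
    × Σ ℕ (λ n → Σ (Graph n) (λ G → IsSingleApprovalIntervalGraph G × ¬ IsIntervalGraph G))
theorem24 =
  (λ _ → interval⇒singleApproval) ,
  4 , C₄ , approvalGraph-isSingleApproval C₄-intervals , C₄-notInterval
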